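{- Let $\varepsilon_1,\varepsilon_2,\varepsilon_3,\varepsilon_4\in\mathbb{Z}_2^\times$. Each of the following $\mathbb{Z}_2$-lattices represents every element of $2\mathbb{Z}_2^\times$: (i) $\langle\varepsilon_1,\varepsilon_2,\varepsilon_3\rangle$; (ii) $\langle\varepsilon_1,2\varepsilon_2,\lambda\varepsilon_3\rangle$ with $\lambda\in\{2,8\}$; (iii) $\langle\varepsilon_1,2\varepsilon_2,4\varepsilon_3,\lambda\varepsilon_4\rangle$ with $\lambda\in\{1,4\}$; (iv) $\widehat{\mathbb{A}}\perp\langle2\varepsilon_1,\lambda\varepsilon_2\rangle$ with $\lambda\in\{2,4,8\}$.
   Context: $\langle a_1,\ldots,a_n\rangle$ denotes a $\mathbb{Z}_2$-lattice with an orthogonal basis $v_1,\ldots,v_n$ such that $q(v_i)=a_i$, where $q$ is the quadratic map. $\widehat{\mathbb{A}}$ denotes the binary $\mathbb{Z}_2$-lattice with Gram matrix $\begin{pmatrix}1&1/2\\1/2&1\end{pmatrix}$, i.e. $q(x_1v_1+x_2v_2)=x_1^2+x_1x_2+x_2^2$; $\perp$ is orthogonal sum. An element $\alpha$ is represented by $L$ if $\alpha=q(v)$ for some $v\in L$. -}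

module Defs where

open import Data.Nat using (ℕ; zero; suc; _+_; _*_; _^_; NonZero)
open import Data.Nat.Properties using (m^n≢0)
open import Data.Nat.DivMod using (_%_; %-distribˡ-+; %-distribˡ-*)
open import Data.Product using (Σ; ∃; _×_; _,_)
open import Data.Vec using (Vec; []; _∷_; splitAt; _++_)
open import Relation.Binary.PropositionalEquality using (_≡_; refl; cong₂; trans; sym)

-- An element is a sequence of natural numbers r n, where r n is a
-- representative of the residue class modulo 2ⁿ, subject to the
-- compatibility condition r (n+1) ≡ r n (mod 2ⁿ).

_mod2^_ : ℕ → ℕ → ℕ
a mod2^ n = _%_ a (2 ^ n) {{m^n≢0 2 n}}

record ℤ₂ : Set where
  constructor mkℤ₂
  field
    r   : ℕ → ℕ
    coh : ∀ n → r (suc n) mod2^ n ≡ r n mod2^ n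
open ℤ₂ public

_≈_ : ℤ₂ → ℤ₂ → Set
x ≈ y = ∀ n → r x n mod2^ n ≡ r y n mod2^ n

infix 4 _≈_
infixl 6 _+₂_
infixl 7 _*₂_

_+₂_ : ℤ₂ → ℤ₂ → ℤ₂
x +₂ y = mkℤ₂ (λ n → r x n + r y n) pf
  where
  pf : ∀ n → (r x (suc n) + r y (suc n)) mod2^ n ≡ (r x n + r y n) mod2^ n
  pf n = trans (%-distribˡ-+ (r x (suc n)) (r y (suc n)) (2 ^ n) {{m^n≢0 2 n}})
           (trans (cong₂ (λ a b → (a + b) mod2^ n) (coh x n) (coh y n))
             (sym (%-distribˡ-+ (r x n) (r y n) (2 ^ n) {{m^n≢0 2 n}})))

_*₂_ : ℤ₂ → ℤ₂ → ℤ₂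
x *₂ y = mkℤ₂ (λ n → r x n * r y n) pf
  where
  pf : ∀ n → (r x (suc n) * r y (suc n)) mod2^ n ≡ (r x n * r y n) mod2^ n
  pf n = trans (%-distribˡ-* (r x (suc n)) (r y (suc n)) (2 ^ n) {{m^n≢0 2 n}})
           (trans (cong₂ (λ a b → (a * b) mod2^ n) (coh x n) (coh y n))
             (sym (%-distribˡ-* (r x n) (r y n) (2 ^ n) {{m^n≢0 2 n}})))

ι : ℕ → ℤ₂
ι k = mkℤ₂ (λ _ → k) (λ _ → refl)

IsUnit : ℤ₂ → Set
IsUnit x = ∃ λ y → x *₂ y ≈ ι 1

In2Units : ℤ₂ → Set
In2Units α = ∃ λ ε → IsUnit ε × α ≈ ι 2 *₂ ε

-- Quadratic ℤ₂-lattices, given by their rank and quadratic map on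
-- coordinate vectors with respect to a fixed basis.

record QLattice : Set where
  constructor mkQL
  field
    rank : ℕ
    q    : Vec ℤ₂ rank → ℤ₂
open QLattice public

Represents : QLattice → ℤ₂ → Set
Represents L α = ∃ λ (v : Vec ℤ₂ (rank L)) → q L v ≈ α

diagQ : ∀ {n} → Vec ℤ₂ n → Vec ℤ₂ n → ℤ₂
diagQ []       []       = ι 0
diagQ (a ∷ as) (x ∷ xs) = a *₂ x *₂ x +₂ diagQ as xs

⟨_⟩ : ∀ {n} → Vec ℤ₂ n → QLattice
⟨_⟩ {n} as = mkQL n (diagQ as)

Â : QLattice
Â = mkQL 2 f
  where
  f : Vec ℤ₂ 2 → ℤ₂
  f (x ∷ y ∷ []) = x *₂ x +₂ x *₂ y +₂ y *₂ y

_⊥_ : QLattice → QLattice → QLattice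
L ⊥ M = mkQL (rank L + rank M) f
  where
  f : Vec ℤ₂ (rank L + rank M) → ℤ₂
  f v with splitAt (rank L) v
  ... | (u , w , _) = q L u +₂ q M w

-- Hensel's lemma at 2: if b = 2ᵏo with o odd and k ≤ 1, and b + c ≡ α (mod 2^(k+3)), then
-- b y² + c = α has a 2-adic solution. An odd y solving it modulo 2^m (m ≥ k + 3) either solves it
-- modulo 2^(m+1) already, or y + 2^(m-k-1) does, since that shift changes b y² by 2^m modulo
-- 2^(m+1). So a lattice represents α as soon as some vector whose coordinate at such a coefficient
-- is 1 represents α modulo 16. Modulo 16 the units εᵢ and α/2 fall into finitely many odd residue
-- classes, and for each lattice a decision procedure checks that every combination of classes
-- admits such a vector.
module Submission where

open import Defs
open import Data.Empty using (⊥-elim)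
open import Data.Fin using (Fin; zero; suc)
open import Data.List using (List; []; _∷_; [_]; upTo; filter; allFin; cartesianProduct; cartesianProductWith)
open import Data.List.Membership.Propositional using (_∈_; find)
open import Data.List.Membership.Propositional.Properties using (∈-filter⁺; ∈-upTo⁺)
open import Data.List.Relation.Unary.All as All using (All; all?; []; _∷_)
open import Data.List.Relation.Unary.Any using (Any; any?)
open import Data.Nat using (ℕ; zero; suc; _+_; _*_; _^_; _∸_; _≤_; _≤′_; ≤′-refl; ≤′-step; z≤n; s≤s; NonZero)
open import Data.Nat.Divisibility using (_∣_; divides)
open import Data.Nat.DivMod
  using (_%_; _/_; %-distribˡ-+; %-distribˡ-*; m%n%n≡m%n; [m+kn]%n≡m%n; m≡m%n+[m/n]*n; m%n<n; m∣n⇒o%n%m≡o%m)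
open import Data.Nat.Properties
  using (_≟_; m^n≢0; ^-distribˡ-+-*; m∸n+n≡m; m≤m+n; m≤n+m; n≤1+n; ≤⇒≤′; ≤′⇒≤; 0≢1+n;
         +-cancelʳ-≡; *-comm; *-identityˡ; +-identityʳ; +-commutativeSemigroup)
open import Algebra.Properties.CommutativeSemigroup +-commutativeSemigroup using (x∙yz≈y∙xz; xy∙z≈xz∙y)
open import Data.Nat.Tactic.RingSolver using (solve-∀)
open import Data.Product using (∃; _×_; _,_; proj₁; proj₂; map₂)
open import Data.Sum using (_⊎_; inj₁; inj₂)
open import Data.Vec using (Vec; []; _∷_; map; lookup; insertAt; removeAt)
open import Data.Vec.Relation.Binary.Pointwise.Inductive using (Pointwise; []; _∷_)
open import Function using (_∘_)
open import Relation.Binary.Bundles using (Setoid)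
open import Relation.Binary.PropositionalEquality
  using (_≡_; refl; sym; trans; cong; cong₂; subst; module ≡-Reasoning)
open import Relation.Nullary.Decidable using (Dec; map′; from-yes)
open import Relation.Unary using (Decidable)

infix 4 _≡[_]_
record _≡[_]_ (x n y : ℕ) : Set where
  constructor ≡[]⁺
  field ≡[]⁻ : x mod2^ n ≡ y mod2^ n
open _≡[_]_ public

module _ {n : ℕ} where

  private instance
    2ⁿ≢0 : NonZero (2 ^ n)
    2ⁿ≢0 = m^n≢0 2 n

  ≡[]-refl : ∀ {x} → x ≡[ n ] x
  ≡[]-refl = ≡[]⁺ refl

  ≡[]-reflexive : ∀ {x y} → x ≡ y → x ≡[ n ] y
  ≡[]-reflexive refl = ≡[]-refl

  ≡[]-sym : ∀ {x y} → x ≡[ n ] y → y ≡[ n ] x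
  ≡[]-sym (≡[]⁺ p) = ≡[]⁺ (sym p)

  ≡[]-trans : ∀ {x y z} → x ≡[ n ] y → y ≡[ n ] z → x ≡[ n ] z
  ≡[]-trans (≡[]⁺ p) (≡[]⁺ q) = ≡[]⁺ (trans p q)

  ≡[]-+ : ∀ {x x′ y y′} → x ≡[ n ] x′ → y ≡[ n ] y′ → x + y ≡[ n ] x′ + y′
  ≡[]-+ {x} {x′} {y} {y′} (≡[]⁺ p) (≡[]⁺ q) = ≡[]⁺ (begin
    (x + y) mod2^ n                     ≡⟨ %-distribˡ-+ x y (2 ^ n) ⟩
    (x mod2^ n + y mod2^ n) mod2^ n     ≡⟨ cong₂ (λ a b → (a + b) mod2^ n) p q ⟩
    (x′ mod2^ n + y′ mod2^ n) mod2^ n   ≡⟨ %-distribˡ-+ x′ y′ (2 ^ n) ⟨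
    (x′ + y′) mod2^ n                   ∎)
    where open ≡-Reasoning

  ≡[]-* : ∀ {x x′ y y′} → x ≡[ n ] x′ → y ≡[ n ] y′ → x * y ≡[ n ] x′ * y′
  ≡[]-* {x} {x′} {y} {y′} (≡[]⁺ p) (≡[]⁺ q) = ≡[]⁺ (begin
    (x * y) mod2^ n                     ≡⟨ %-distribˡ-* x y (2 ^ n) ⟩
    (x mod2^ n * y mod2^ n) mod2^ n     ≡⟨ cong₂ (λ a b → (a * b) mod2^ n) p q ⟩
    (x′ mod2^ n * y′ mod2^ n) mod2^ n   ≡⟨ %-distribˡ-* x′ y′ (2 ^ n) ⟨
    (x′ * y′) mod2^ n                   ∎)
    where open ≡-Reasoning

  mod2^-≡[] : ∀ x → x mod2^ n ≡[ n ] x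
  mod2^-≡[] x = ≡[]⁺ (m%n%n≡m%n x (2 ^ n))

  +-*2^-≡[] : ∀ x q → x + q * 2 ^ n ≡[ n ] x
  +-*2^-≡[] x q = ≡[]⁺ ([m+kn]%n≡m%n x q (2 ^ n))

  +-2^-≡[] : ∀ x → x + 2 ^ n ≡[ n ] x
  +-2^-≡[] x = subst (λ z → x + z ≡[ n ] x) (*-identityˡ (2 ^ n)) (+-*2^-≡[] x 1)

  quotients⇒≡[] : ∀ {x y} q₁ q₂ → x + q₁ * 2 ^ n ≡ y + q₂ * 2 ^ n → x ≡[ n ] y
  quotients⇒≡[] {x} {y} q₁ q₂ eq =
    ≡[]-trans (≡[]-sym (+-*2^-≡[] x q₁)) (≡[]-trans (≡[]-reflexive eq) (+-*2^-≡[] y q₂))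

  ≡[]⇒quotients : ∀ {x y} → x ≡[ n ] y → ∃ λ q₁ → ∃ λ q₂ → x + q₁ * 2 ^ n ≡ y + q₂ * 2 ^ n
  ≡[]⇒quotients {x} {y} (≡[]⁺ p) = Y , X , (begin
    x + Y * 2 ^ n                          ≡⟨ cong (_+ Y * 2 ^ n) (m≡m%n+[m/n]*n x (2 ^ n)) ⟩
    x mod2^ n + X * 2 ^ n + Y * 2 ^ n      ≡⟨ swap (x mod2^ n) (X * 2 ^ n) (Y * 2 ^ n) ⟩
    x mod2^ n + Y * 2 ^ n + X * 2 ^ n      ≡⟨ cong (λ z → z + Y * 2 ^ n + X * 2 ^ n) p ⟩
    y mod2^ n + Y * 2 ^ n + X * 2 ^ n      ≡⟨ cong (_+ X * 2 ^ n) (m≡m%n+[m/n]*n y (2 ^ n)) ⟨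
    y + X * 2 ^ n                          ∎)
    where
    open ≡-Reasoning
    X = x / 2 ^ n
    Y = y / 2 ^ n
    swap : ∀ a b c → a + b + c ≡ a + c + b
    swap = solve-∀

≡[]-setoid : ℕ → Setoid _ _
≡[]-setoid n = record
  { Carrier       = ℕ
  ; _≈_           = λ x y → x ≡[ n ] y
  ; isEquivalence = record { refl = ≡[]-refl ; sym = ≡[]-sym ; trans = ≡[]-trans }
  }

module ≡[]-Reasoning (n : ℕ) where
  open import Relation.Binary.Reasoning.Setoid (≡[]-setoid n) public

2^∣2^ : ∀ {m n} → m ≤ n → 2 ^ m ∣ 2 ^ n
2^∣2^ {m} {n} m≤n =
  divides (2 ^ (n ∸ m)) (trans (cong (2 ^_) (sym (m∸n+n≡m m≤n))) (^-distribˡ-+-* 2 (n ∸ m) m))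

≡[]-weaken : ∀ {m n x y} → m ≤ n → x ≡[ n ] y → x ≡[ m ] y
≡[]-weaken {m} {n} {x} {y} m≤n (≡[]⁺ p) = ≡[]⁺ (begin
  x mod2^ m              ≡⟨ mod-mod x ⟨
  (x mod2^ n) mod2^ m    ≡⟨ cong (_mod2^ m) p ⟩
  (y mod2^ n) mod2^ m    ≡⟨ mod-mod y ⟩
  y mod2^ m              ∎)
  where
  open ≡-Reasoning
  mod-mod : ∀ z → (z mod2^ n) mod2^ m ≡ z mod2^ m
  mod-mod z = m∣n⇒o%n%m≡o%m (2 ^ m) (2 ^ n) z {{m^n≢0 2 m}} {{m^n≢0 2 n}} (2^∣2^ m≤n)

≡[]-*2^ : ∀ k {n x y} → x ≡[ n ] y → 2 ^ k * x ≡[ k + n ] 2 ^ k * y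
≡[]-*2^ k {n} {x} {y} p with q₁ , q₂ , eq ← ≡[]⇒quotients p =
  quotients⇒≡[] q₁ q₂ (begin
    2 ^ k * x + q₁ * 2 ^ (k + n)        ≡⟨ cong (λ z → 2 ^ k * x + q₁ * z) (^-distribˡ-+-* 2 k n) ⟩
    2 ^ k * x + q₁ * (2 ^ k * 2 ^ n)    ≡⟨ scale (2 ^ k) x q₁ (2 ^ n) ⟩
    2 ^ k * (x + q₁ * 2 ^ n)            ≡⟨ cong (2 ^ k *_) eq ⟩
    2 ^ k * (y + q₂ * 2 ^ n)            ≡⟨ scale (2 ^ k) y q₂ (2 ^ n) ⟨
    2 ^ k * y + q₂ * (2 ^ k * 2 ^ n)    ≡⟨ cong (λ z → 2 ^ k * y + q₂ * z) (^-distribˡ-+-* 2 k n) ⟨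
    2 ^ k * y + q₂ * 2 ^ (k + n)        ∎)
  where
  open ≡-Reasoning
  scale : ∀ K x q N → K * x + q * (K * N) ≡ K * (x + q * N)
  scale = solve-∀

parity : ∀ q → ∃ λ h → q ≡ h * 2 ⊎ q ≡ 1 + h * 2
parity zero = 0 , inj₁ refl
parity (suc q) with parity q
... | h , inj₁ refl = h , inj₂ refl
... | h , inj₂ refl = suc h , inj₁ refl

≡[]-lift : ∀ {n x y} → x ≡[ n ] y → x ≡[ suc n ] y ⊎ x + 2 ^ n ≡[ suc n ] y
≡[]-lift {n} {x} {y} p with q₁ , q₂ , eq ← ≡[]⇒quotients p | parity q₁ | parity q₂
... | h₁ , inj₁ refl | h₂ , inj₁ refl = inj₁ (quotients⇒≡[] h₁ h₂ (begin
  x + h₁ * (2 * 2 ^ n)            ≡⟨ even x h₁ (2 ^ n) ⟩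
  x + h₁ * 2 * 2 ^ n              ≡⟨ eq ⟩
  y + h₂ * 2 * 2 ^ n              ≡⟨ even y h₂ (2 ^ n) ⟨
  y + h₂ * (2 * 2 ^ n)            ∎))
  where
  open ≡-Reasoning
  even : ∀ x h D → x + h * (2 * D) ≡ x + h * 2 * D
  even = solve-∀
... | h₁ , inj₂ refl | h₂ , inj₂ refl = inj₁ (quotients⇒≡[] h₁ h₂ (+-cancelʳ-≡ _ _ _ (begin
  x + h₁ * (2 * 2 ^ n) + 2 ^ n    ≡⟨ odd x h₁ (2 ^ n) ⟩
  x + (1 + h₁ * 2) * 2 ^ n        ≡⟨ eq ⟩
  y + (1 + h₂ * 2) * 2 ^ n        ≡⟨ odd y h₂ (2 ^ n) ⟨
  y + h₂ * (2 * 2 ^ n) + 2 ^ n    ∎)))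
  where
  open ≡-Reasoning
  odd : ∀ x h D → x + h * (2 * D) + D ≡ x + (1 + h * 2) * D
  odd = solve-∀
... | h₁ , inj₁ refl | h₂ , inj₂ refl = inj₂ (quotients⇒≡[] h₁ (1 + h₂) (begin
  x + 2 ^ n + h₁ * (2 * 2 ^ n)      ≡⟨ even-odd x h₁ (2 ^ n) ⟩
  x + h₁ * 2 * 2 ^ n + 2 ^ n        ≡⟨ cong (_+ 2 ^ n) eq ⟩
  y + (1 + h₂ * 2) * 2 ^ n + 2 ^ n  ≡⟨ odd-odd y h₂ (2 ^ n) ⟩
  y + (1 + h₂) * (2 * 2 ^ n)        ∎))
  where
  open ≡-Reasoning
  even-odd : ∀ x h D → x + D + h * (2 * D) ≡ x + h * 2 * D + D
  even-odd = solve-∀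
  odd-odd : ∀ y h D → y + (1 + h * 2) * D + D ≡ y + (1 + h) * (2 * D)
  odd-odd = solve-∀
... | h₁ , inj₂ refl | h₂ , inj₁ refl = inj₂ (quotients⇒≡[] h₁ h₂ (begin
  x + 2 ^ n + h₁ * (2 * 2 ^ n)    ≡⟨ odd-even x h₁ (2 ^ n) ⟩
  x + (1 + h₁ * 2) * 2 ^ n        ≡⟨ eq ⟩
  y + h₂ * 2 * 2 ^ n              ≡⟨ even y h₂ (2 ^ n) ⟨
  y + h₂ * (2 * 2 ^ n)            ∎))
  where
  open ≡-Reasoning
  odd-even : ∀ x h D → x + D + h * (2 * D) ≡ x + (1 + h * 2) * D
  odd-even = solve-∀
  even : ∀ y h D → y + h * (2 * D) ≡ y + h * 2 * D
  even = solve-∀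

infix 4 _≡[_]?_
_≡[_]?_ : ∀ x n y → Dec (x ≡[ n ] y)
x ≡[ n ]? y = map′ ≡[]⁺ ≡[]⁻ (x mod2^ n ≟ y mod2^ n)

Odd : ℕ → Set
Odd x = x ≡[ 1 ] 1

odd? : ∀ x → Dec (Odd x)
odd? x = x ≡[ 1 ]? 1

Odd⇒≡1+2* : ∀ {x} → Odd x → ∃ λ g → x ≡ 1 + 2 * g
Odd⇒≡1+2* {x} (≡[]⁺ x%2≡1) = x / 2 , (begin
  x                    ≡⟨ m≡m%n+[m/n]*n x 2 ⟩
  x % 2 + x / 2 * 2    ≡⟨ cong₂ _+_ x%2≡1 (*-comm (x / 2) 2) ⟩
  1 + 2 * (x / 2)      ∎)
  where open ≡-Reasoning

odd-*⁻ˡ : ∀ {x y} → Odd (x * y) → Odd x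
odd-*⁻ˡ {x} {y} xy-odd with parity x
... | h , inj₂ refl = +-*2^-≡[] {1} 1 h
... | h , inj₁ refl = ⊥-elim (0≢1+n (≡[]⁻ (≡[]-trans (≡[]-sym even) xy-odd)))
  where
  reorder : ∀ h y → h * 2 * y + 0 * 2 ≡ 0 + h * y * 2
  reorder = solve-∀
  even : h * 2 * y ≡[ 1 ] 0
  even = quotients⇒≡[] 0 (h * y) (reorder h y)

infix 4 _≈[_]_
_≈[_]_ : ℤ₂ → ℕ → ℤ₂ → Set
x ≈[ m ] y = r x m ≡[ m ] r y m

residue-coherent : ∀ x {m n} → m ≤ n → r x n ≡[ m ] r x m
residue-coherent x {m} m≤n = go (≤⇒≤′ m≤n)
  where
  go : ∀ {n} → m ≤′ n → r x n ≡[ m ] r x m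
  go ≤′-refl                 = ≡[]-refl
  go {suc n} (≤′-step m≤′n) = ≡[]-trans (≡[]-weaken (≤′⇒≤ m≤′n) (≡[]⁺ (coh x n))) (go m≤′n)

≈[]-weaken : ∀ {m n x y} → m ≤ n → x ≈[ n ] y → x ≈[ m ] y
≈[]-weaken {x = x} {y} m≤n x≈y =
  ≡[]-trans (≡[]-sym (residue-coherent x m≤n)) (≡[]-trans (≡[]-weaken m≤n x≈y) (residue-coherent y m≤n))

≈[]-*2^ : ∀ k {m n x e} → k + m ≡ n → x ≈[ m ] ι e → ι (2 ^ k) *₂ x ≈[ n ] ι (2 ^ k * e)
≈[]-*2^ k {m} {x = x} refl x≈e = ≡[]-*2^ k (≡[]-trans (residue-coherent x (m≤n+m m k)) x≈e)

unit⇒odd : ∀ {ε} → IsUnit ε → ∀ n → Odd (r ε (suc n))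
unit⇒odd {ε} (_ , εε⁻¹≈1) n = ≡[]-trans (residue-coherent ε (s≤s z≤n)) (odd-*⁻ˡ (≡[]⁺ (εε⁻¹≈1 1)))

-- Hensel lifting

HasValuation : ℕ → ℤ₂ → Set
HasValuation k b = ∀ n → ∃ λ o → Odd o × r b (suc n) ≡ 2 ^ k * o

unit-valuation : ∀ {ε} → IsUnit ε → HasValuation 0 ε
unit-valuation {ε} u n = r ε (suc n) , unit⇒odd {ε} u n , sym (+-identityʳ _)

twice-unit-valuation : ∀ {ε} → IsUnit ε → HasValuation 1 (ι 2 *₂ ε)
twice-unit-valuation {ε} u n = r ε (suc n) , unit⇒odd {ε} u n , refl

square-shift : ∀ k t {o y} → Odd (o * y) →
  2 ^ k * o * (y + 2 ^ (2 + t)) * (y + 2 ^ (2 + t)) ≡[ suc (t + (3 + k)) ] 2 ^ k * o * y * y + 2 ^ (t + (3 + k))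
square-shift k t {o} {y} oy-odd with g , oy≡1+2g ← Odd⇒≡1+2* oy-odd = begin
  K * o * (y + 2 ^ (2 + t)) * (y + 2 ^ (2 + t))         ≡⟨ expand K o y D ⟩
  K * o * y * y + M′ * (o * y) + D * o * (2 * M′)       ≡⟨ cong (λ z → K * o * y * y + M′ * z + D * o * (2 * M′)) oy≡1+2g ⟩
  K * o * y * y + M′ * (1 + 2 * g) + D * o * (2 * M′)   ≡⟨ regroup (K * o * y * y) M′ g (D * o) ⟩
  K * o * y * y + M′ + (g + D * o) * (2 * M′)           ≡⟨ cong (λ z → K * o * y * y + z + (g + D * o) * (2 * z)) M≡M′ ⟨
  K * o * y * y + M + (g + D * o) * 2 ^ suc m           ≈⟨ +-*2^-≡[] (K * o * y * y + M) (g + D * o) ⟩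
  K * o * y * y + M                                     ∎
  where
  open ≡[]-Reasoning (suc (t + (3 + k)))
  m = t + (3 + k)
  K = 2 ^ k
  D = 2 ^ t
  M = 2 ^ m
  M′ = D * (2 * (2 * (2 * K)))
  M≡M′ : M ≡ M′
  M≡M′ = ^-distribˡ-+-* 2 t (3 + k)
  expand : ∀ K o y D → K * o * (y + 2 * (2 * D)) * (y + 2 * (2 * D))
    ≡ K * o * y * y + D * (2 * (2 * (2 * K))) * (o * y) + D * o * (2 * (D * (2 * (2 * (2 * K)))))
  expand = solve-∀
  regroup : ∀ A M g B → A + M * (1 + 2 * g) + B * (2 * M) ≡ A + M + (g + B) * (2 * M)
  regroup = solve-∀

module SquareLifting (k : ℕ) (b c α : ℤ₂) (val : HasValuation k b)
                     (base : b *₂ ι 1 *₂ ι 1 +₂ c ≈[ 3 + k ] α) where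

  Approx : ℕ → ℕ → Set
  Approx m y = Odd y × r b m * y * y + r c m ≡[ m ] r α m

  coefficients-≡[] : ∀ {m n} y → m ≤ n → r b n * y * y + r c n ≡[ m ] r b m * y * y + r c m
  coefficients-≡[] y m≤n = ≡[]-+ (≡[]-* (≡[]-* (residue-coherent b m≤n) ≡[]-refl) ≡[]-refl) (residue-coherent c m≤n)

  next-level : ∀ {m y} → Approx m y → r b (suc m) * y * y + r c (suc m) ≡[ m ] r α (suc m)
  next-level {m} {y} (_ , approx) =
    ≡[]-trans (coefficients-≡[] y (n≤1+n m)) (≡[]-trans approx (≡[]-sym (residue-coherent α (n≤1+n m))))

  shift-effect : ∀ t {y} → Odd y → let m = t + (3 + k) in
    r b (suc m) * (y + 2 ^ (2 + t)) * (y + 2 ^ (2 + t)) + r c (suc m)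
      ≡[ suc m ] r b (suc m) * y * y + r c (suc m) + 2 ^ m
  shift-effect t {y} y-odd with o , o-odd , b≡2^ko ← val (t + (3 + k)) rewrite b≡2^ko =
    ≡[]-trans (≡[]-+ (square-shift k t (≡[]-* o-odd y-odd)) ≡[]-refl)
              (≡[]-reflexive (xy∙z≈xz∙y (2 ^ k * o * y * y) (2 ^ (t + (3 + k))) (r c (suc (t + (3 + k))))))

  lift-step : ∀ t {y} → Approx (t + (3 + k)) y → ∃ λ y′ → Approx (suc t + (3 + k)) y′ × y′ ≡[ t ] y
  lift-step t {y} approx@(y-odd , _) with ≡[]-lift (next-level approx)
  ... | inj₁ exact = y , (y-odd , exact) , ≡[]-refl
  ... | inj₂ off   = y + 2 ^ (2 + t) , (shifted-odd , ≡[]-trans (shift-effect t y-odd) off) ,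
                     ≡[]-weaken (m≤n+m t 2) (+-2^-≡[] {2 + t} y)
    where
    shifted-odd : Odd (y + 2 ^ (2 + t))
    shifted-odd = ≡[]-trans (≡[]-weaken (s≤s z≤n) (+-2^-≡[] {2 + t} y)) y-odd

  approx : ∀ t → ∃ (Approx (t + (3 + k)))
  approx zero    = 1 , ≡[]-refl , base
  approx (suc t) = map₂ proj₁ (lift-step t (proj₂ (approx t)))

  solution : ℤ₂
  solution = mkℤ₂ (λ t → proj₁ (approx t)) (λ t → ≡[]⁻ (proj₂ (proj₂ (lift-step t (proj₂ (approx t))))))

  solution-correct : b *₂ solution *₂ solution +₂ c ≈ α
  solution-correct n = ≡[]⁻ (begin
    r b n * y * y + r c n                          ≈⟨ coefficients-≡[] y n≤n+3+k ⟨
    r b (n + (3 + k)) * y * y + r c (n + (3 + k))  ≈⟨ ≡[]-weaken n≤n+3+k (proj₂ (proj₂ (approx n))) ⟩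
    r α (n + (3 + k))                              ≈⟨ residue-coherent α n≤n+3+k ⟩
    r α n                                          ∎)
    where
    open ≡[]-Reasoning n
    y = proj₁ (approx n)
    n≤n+3+k = m≤m+n n (3 + k)

square-lift : ∀ k b c α → HasValuation k b → b *₂ ι 1 *₂ ι 1 +₂ c ≈[ 3 + k ] α →
              ∃ λ y → b *₂ y *₂ y +₂ c ≈ α
square-lift k b c α val base = solution , solution-correct
  where open SquareLifting k b c α val base

-- Reduction to a finite search modulo 16

odds : ℕ → List ℕ
odds n = filter odd? (upTo n)

AllOdd : ℕ → (ℕ → Set) → Set
AllOdd m P = All P (odds (2 ^ m))

allOdd? : ∀ m {P : ℕ → Set} → Decidable P → Dec (AllOdd m P)
allOdd? m P? = all? P? (odds (2 ^ m))

unit-residue : ∀ m {ε P} → IsUnit ε → AllOdd (suc m) P → ∃ λ e → ε ≈[ suc m ] ι e × P e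
unit-residue m {ε} u table = e , ≡[]-sym e≡ε , All.lookup table (∈-filter⁺ odd? e<2^m e-odd)
  where
  e = r ε (suc m) mod2^ suc m
  e≡ε : e ≡[ suc m ] r ε (suc m)
  e≡ε = mod2^-≡[] (r ε (suc m))
  e<2^m : e ∈ upTo (2 ^ suc m)
  e<2^m = ∈-upTo⁺ (m%n<n (r ε (suc m)) (2 ^ suc m) {{m^n≢0 2 (suc m)}})
  e-odd : Odd e
  e-odd = ≡[]-trans (≡[]-weaken (s≤s z≤n) e≡ε) (unit⇒odd {ε} u m)

target-residue : ∀ {α P} → In2Units α → AllOdd 3 P → ∃ λ u → α ≈[ 4 ] ι (2 * u) × P u
target-residue (ε , u , α≈2ε) table =
  let e , ε≈e , Pe = unit-residue 2 {ε} u table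
  in e , ≡[]-trans (≡[]⁺ (α≈2ε 4)) (≈[]-*2^ 1 {x = ε} refl ε≈e) , Pe

diagQ-cong : ∀ {n m} {as bs : Vec ℤ₂ n} → Pointwise _≈[ m ]_ as bs → ∀ xs → diagQ as xs ≈[ m ] diagQ bs xs
diagQ-cong []              []       = ≡[]-refl
diagQ-cong (a≈b ∷ as≈bs) (x ∷ xs) = ≡[]-+ (≡[]-* (≡[]-* a≈b ≡[]-refl) ≡[]-refl) (diagQ-cong as≈bs xs)

diagQ-insertAt : ∀ {n} (as : Vec ℤ₂ (suc n)) xs i y m →
  r (diagQ as (insertAt xs i y)) m ≡ r (lookup as i *₂ y *₂ y +₂ diagQ (removeAt as i) xs) m
diagQ-insertAt (a ∷ as)          xs       zero    y m = refl
diagQ-insertAt (a ∷ as@(_ ∷ _)) (x ∷ xs) (suc i) y m =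
  trans (cong (r a m * r x m * r x m +_) (diagQ-insertAt as xs i y m))
        (x∙yz≈y∙xz (r a m * r x m * r x m) (r (lookup as i *₂ y *₂ y) m) (r (diagQ (removeAt as i) xs) m))

Liftable : ℤ₂ → Set
Liftable b = ∃ λ k → k ≤ 1 × HasValuation k b

unit-liftable : ∀ {ε} → IsUnit ε → Liftable ε
unit-liftable {ε} u = 0 , z≤n , unit-valuation {ε} u

twice-unit-liftable : ∀ {ε} → IsUnit ε → Liftable (ι 2 *₂ ε)
twice-unit-liftable {ε} u = 1 , s≤s z≤n , twice-unit-valuation {ε} u

lift-at-coordinate : ∀ {n} c (as : Vec ℤ₂ (suc n)) i xs {α} → Liftable (lookup as i) →
  c +₂ diagQ as (insertAt xs i (ι 1)) ≈[ 4 ] α → ∃ λ v → c +₂ diagQ as v ≈ α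
lift-at-coordinate c as i xs {α} (k , k≤1 , val) approx =
  let y , y-solves = square-lift k (lookup as i) rest α val base
  in insertAt xs i y , λ m → trans (cong (_mod2^ m) (split y m)) (y-solves m)
  where
  rest = c +₂ diagQ (removeAt as i) xs
  split : ∀ y m → r (c +₂ diagQ as (insertAt xs i y)) m ≡ r (lookup as i *₂ y *₂ y +₂ rest) m
  split y m = trans (cong (r c m +_) (diagQ-insertAt as xs i y m))
                    (x∙yz≈y∙xz (r c m) (r (lookup as i *₂ y *₂ y) m) (r (diagQ (removeAt as i) xs) m))
  base : lookup as i *₂ ι 1 *₂ ι 1 +₂ rest ≈[ 3 + k ] α
  base = ≈[]-weaken {x = lookup as i *₂ ι 1 *₂ ι 1 +₂ rest} {α} (s≤s (s≤s (s≤s k≤1)))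
                    (≡[]-trans (≡[]-reflexive (sym (split (ι 1) 4))) approx)

vecs : ∀ {A : Set} → List A → (n : ℕ) → List (Vec A n)
vecs xs zero    = [ [] ]
vecs xs (suc n) = cartesianProductWith _∷_ xs (vecs xs n)

candidate : ∀ {n} → Fin (suc n) → Vec ℕ n → Vec ℤ₂ (suc n)
candidate i ws = insertAt (map ι ws) i (ι 1)

Solves : ∀ {n} → ℤ₂ → Vec ℕ (suc n) → ℕ → Fin (suc n) → Vec ℕ n → Set
Solves c es u i ws = c +₂ diagQ (map ι es) (candidate i ws) ≈[ 4 ] ι (2 * u)

-- The other coordinates only need to range over 0, …, 3: their squares 0, 1, 4, 9 are all the
-- squares modulo 16.
Solutions : ∀ {n} → ℤ₂ → Vec ℕ (suc n) → ℕ → List (Fin (suc n)) → Set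
Solutions {n} c es u ps = Any (λ i → Any (Solves c es u i) (vecs (upTo 4) n)) ps

solutions? : ∀ {n} c (es : Vec ℕ (suc n)) u ps → Dec (Solutions c es u ps)
solutions? c es u ps =
  any? (λ i → any? (λ ws → r (c +₂ diagQ (map ι es) (candidate i ws)) 4 ≡[ 4 ]? 2 * u) _) ps

lift-solution : ∀ {n} c (as : Vec ℤ₂ (suc n)) es {α} u ps →
  Pointwise _≈[ 4 ]_ as (map ι es) → α ≈[ 4 ] ι (2 * u) →
  All (Liftable ∘ lookup as) ps → Solutions c es u ps →
  ∃ λ v → c +₂ diagQ as v ≈ α
lift-solution c as es {α} u ps as≈es α≈2u liftable sols =
  let i , i∈ps , sols-at-i = find sols
      ws , _ , solves = find sols-at-i
  in lift-at-coordinate c as i (map ι ws) {α} (All.lookup liftable i∈ps)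
       (≡[]-trans (≡[]-+ (≡[]-refl {x = r c 4}) (diagQ-cong as≈es (candidate i ws)))
                  (≡[]-trans solves (≡[]-sym α≈2u)))

-- A coefficient 2ᵏε is determined modulo 16 by ε modulo 2⁴⁻ᵏ, so each unit is enumerated only to
-- that precision; u runs over the odd residues of α/2 modulo 8.
Table-i : Set
Table-i = AllOdd 4 λ e₁ → AllOdd 4 λ e₂ → AllOdd 4 λ e₃ → AllOdd 3 λ u →
  Solutions (ι 0) (e₁ ∷ e₂ ∷ e₃ ∷ []) u (allFin 3)

table-i? : Dec Table-i
table-i? = allOdd? 4 λ e₁ → allOdd? 4 λ e₂ → allOdd? 4 λ e₃ → allOdd? 3 λ u →
  solutions? (ι 0) (e₁ ∷ e₂ ∷ e₃ ∷ []) u (allFin 3)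

represents-i : Table-i → (ε₁ ε₂ ε₃ : ℤ₂) → IsUnit ε₁ → IsUnit ε₂ → IsUnit ε₃ →
  (α : ℤ₂) → In2Units α → Represents ⟨ ε₁ ∷ ε₂ ∷ ε₃ ∷ [] ⟩ α
represents-i table ε₁ ε₂ ε₃ u₁ u₂ u₃ α α∈2ℤ₂ˣ =
  let e₁ , ε₁≈ , table₁ = unit-residue 3 {ε₁} u₁ table
      e₂ , ε₂≈ , table₂ = unit-residue 3 {ε₂} u₂ table₁
      e₃ , ε₃≈ , table₃ = unit-residue 3 {ε₃} u₃ table₂
      u  , α≈  , sols   = target-residue {α} α∈2ℤ₂ˣ table₃
  in lift-solution (ι 0) (ε₁ ∷ ε₂ ∷ ε₃ ∷ []) (e₁ ∷ e₂ ∷ e₃ ∷ []) {α} u (allFin 3)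
       (ε₁≈ ∷ ε₂≈ ∷ ε₃≈ ∷ []) α≈
       (unit-liftable {ε₁} u₁ ∷ unit-liftable {ε₂} u₂ ∷ unit-liftable {ε₃} u₃ ∷ []) sols

Table-ii : ℕ → ℕ → Set
Table-ii k m = AllOdd 4 λ e₁ → AllOdd 3 λ e₂ → AllOdd (suc m) λ e₃ → AllOdd 3 λ u →
  Solutions (ι 0) (e₁ ∷ 2 * e₂ ∷ 2 ^ k * e₃ ∷ []) u [ suc zero ]

table-ii? : ∀ k m → Dec (Table-ii k m)
table-ii? k m = allOdd? 4 λ e₁ → allOdd? 3 λ e₂ → allOdd? (suc m) λ e₃ → allOdd? 3 λ u →
  solutions? (ι 0) (e₁ ∷ 2 * e₂ ∷ 2 ^ k * e₃ ∷ []) u [ suc zero ]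

represents-ii : ∀ k m → k + suc m ≡ 4 → Table-ii k m →
  (ε₁ ε₂ ε₃ : ℤ₂) → IsUnit ε₁ → IsUnit ε₂ → IsUnit ε₃ →
  (α : ℤ₂) → In2Units α → Represents ⟨ ε₁ ∷ ι 2 *₂ ε₂ ∷ ι (2 ^ k) *₂ ε₃ ∷ [] ⟩ α
represents-ii k m k+m≡4 table ε₁ ε₂ ε₃ u₁ u₂ u₃ α α∈2ℤ₂ˣ =
  let e₁ , ε₁≈ , table₁ = unit-residue 3 {ε₁} u₁ table
      e₂ , ε₂≈ , table₂ = unit-residue 2 {ε₂} u₂ table₁
      e₃ , ε₃≈ , table₃ = unit-residue m {ε₃} u₃ table₂
      u  , α≈  , sols   = target-residue {α} α∈2ℤ₂ˣ table₃
  in lift-solution (ι 0) (ε₁ ∷ ι 2 *₂ ε₂ ∷ ι (2 ^ k) *₂ ε₃ ∷ []) (e₁ ∷ 2 * e₂ ∷ 2 ^ k * e₃ ∷ []) {α} u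
       [ suc zero ]
       (ε₁≈ ∷ ≈[]-*2^ 1 {x = ε₂} refl ε₂≈ ∷ ≈[]-*2^ k {x = ε₃} k+m≡4 ε₃≈ ∷ []) α≈
       (twice-unit-liftable {ε₂} u₂ ∷ []) sols

Table-iii : ℕ → ℕ → Set
Table-iii k m = AllOdd 4 λ e₁ → AllOdd 3 λ e₂ → AllOdd 2 λ e₃ → AllOdd (suc m) λ e₄ → AllOdd 3 λ u →
  Solutions (ι 0) (e₁ ∷ 2 * e₂ ∷ 4 * e₃ ∷ 2 ^ k * e₄ ∷ []) u (zero ∷ suc zero ∷ [])

table-iii? : ∀ k m → Dec (Table-iii k m)
table-iii? k m = allOdd? 4 λ e₁ → allOdd? 3 λ e₂ → allOdd? 2 λ e₃ → allOdd? (suc m) λ e₄ → allOdd? 3 λ u →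
  solutions? (ι 0) (e₁ ∷ 2 * e₂ ∷ 4 * e₃ ∷ 2 ^ k * e₄ ∷ []) u (zero ∷ suc zero ∷ [])

represents-iii : ∀ k m → k + suc m ≡ 4 → Table-iii k m →
  (ε₁ ε₂ ε₃ ε₄ : ℤ₂) → IsUnit ε₁ → IsUnit ε₂ → IsUnit ε₃ → IsUnit ε₄ →
  (α : ℤ₂) → In2Units α → Represents ⟨ ε₁ ∷ ι 2 *₂ ε₂ ∷ ι 4 *₂ ε₃ ∷ ι (2 ^ k) *₂ ε₄ ∷ [] ⟩ α
represents-iii k m k+m≡4 table ε₁ ε₂ ε₃ ε₄ u₁ u₂ u₃ u₄ α α∈2ℤ₂ˣ =
  let e₁ , ε₁≈ , table₁ = unit-residue 3 {ε₁} u₁ table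
      e₂ , ε₂≈ , table₂ = unit-residue 2 {ε₂} u₂ table₁
      e₃ , ε₃≈ , table₃ = unit-residue 1 {ε₃} u₃ table₂
      e₄ , ε₄≈ , table₄ = unit-residue m {ε₄} u₄ table₃
      u  , α≈  , sols   = target-residue {α} α∈2ℤ₂ˣ table₄
  in lift-solution (ι 0) (ε₁ ∷ ι 2 *₂ ε₂ ∷ ι 4 *₂ ε₃ ∷ ι (2 ^ k) *₂ ε₄ ∷ [])
       (e₁ ∷ 2 * e₂ ∷ 4 * e₃ ∷ 2 ^ k * e₄ ∷ []) {α} u (zero ∷ suc zero ∷ [])
       (ε₁≈ ∷ ≈[]-*2^ 1 {x = ε₂} refl ε₂≈ ∷ ≈[]-*2^ 2 {x = ε₃} refl ε₃≈ ∷ ≈[]-*2^ k {x = ε₄} k+m≡4 ε₄≈ ∷ []) α≈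
       (unit-liftable {ε₁} u₁ ∷ twice-unit-liftable {ε₂} u₂ ∷ []) sols

Â-extend : ∀ {n} {ds : Vec ℤ₂ n} {α} a b → (∃ λ v → q Â (ι a ∷ ι b ∷ []) +₂ diagQ ds v ≈ α) →
  Represents (Â ⊥ ⟨ ds ⟩) α
Â-extend a b (v , q≈α) = ι a ∷ ι b ∷ v , q≈α

Â-value : ℕ × ℕ → ℤ₂
Â-value (a , b) = q Â (ι a ∷ ι b ∷ [])

Table-iv : ℕ → ℕ → Set
Table-iv k m = AllOdd 3 λ e₁ → AllOdd (suc m) λ e₂ → AllOdd 3 λ u →
  Any (λ ab → Solutions (Â-value ab) (2 * e₁ ∷ 2 ^ k * e₂ ∷ []) u [ zero ]) (cartesianProduct (upTo 3) (upTo 3))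

table-iv? : ∀ k m → Dec (Table-iv k m)
table-iv? k m = allOdd? 3 λ e₁ → allOdd? (suc m) λ e₂ → allOdd? 3 λ u →
  any? (λ ab → solutions? (Â-value ab) (2 * e₁ ∷ 2 ^ k * e₂ ∷ []) u [ zero ]) (cartesianProduct (upTo 3) (upTo 3))

represents-iv : ∀ k m → k + suc m ≡ 4 → Table-iv k m →
  (ε₁ ε₂ : ℤ₂) → IsUnit ε₁ → IsUnit ε₂ →
  (α : ℤ₂) → In2Units α → Represents (Â ⊥ ⟨ ι 2 *₂ ε₁ ∷ ι (2 ^ k) *₂ ε₂ ∷ [] ⟩) α
represents-iv k m k+m≡4 table ε₁ ε₂ u₁ u₂ α α∈2ℤ₂ˣ =
  let e₁ , ε₁≈ , table₁ = unit-residue 2 {ε₁} u₁ table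
      e₂ , ε₂≈ , table₂ = unit-residue m {ε₂} u₂ table₁
      u  , α≈  , sols-Â = target-residue {α} α∈2ℤ₂ˣ table₂
      (a , b) , _ , sols = find sols-Â
  in Â-extend {ds = ι 2 *₂ ε₁ ∷ ι (2 ^ k) *₂ ε₂ ∷ []} {α} a b
       (lift-solution (Â-value (a , b)) (ι 2 *₂ ε₁ ∷ ι (2 ^ k) *₂ ε₂ ∷ []) (2 * e₁ ∷ 2 ^ k * e₂ ∷ []) {α} u
          [ zero ] (≈[]-*2^ 1 {x = ε₁} refl ε₁≈ ∷ ≈[]-*2^ k {x = ε₂} k+m≡4 ε₂≈ ∷ []) α≈
          (twice-unit-liftable {ε₁} u₁ ∷ []) sols)

lemma5p9 : (ε₁ ε₂ ε₃ ε₄ : ℤ₂) → IsUnit ε₁ → IsUnit ε₂ → IsUnit ε₃ → IsUnit ε₄ →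
      ((α : ℤ₂) → In2Units α → Represents ⟨ ε₁ ∷ ε₂ ∷ ε₃ ∷ [] ⟩ α)
    × ((l : ℕ) → l ≡ 2 ⊎ l ≡ 8 → (α : ℤ₂) → In2Units α →
        Represents ⟨ ε₁ ∷ ι 2 *₂ ε₂ ∷ ι l *₂ ε₃ ∷ [] ⟩ α)
    × ((l : ℕ) → l ≡ 1 ⊎ l ≡ 4 → (α : ℤ₂) → In2Units α →
        Represents ⟨ ε₁ ∷ ι 2 *₂ ε₂ ∷ ι 4 *₂ ε₃ ∷ ι l *₂ ε₄ ∷ [] ⟩ α)
    × ((l : ℕ) → l ≡ 2 ⊎ l ≡ 4 ⊎ l ≡ 8 → (α : ℤ₂) → In2Units α →
        Represents (Â ⊥ ⟨ ι 2 *₂ ε₁ ∷ ι l *₂ ε₂ ∷ [] ⟩) α)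
lemma5p9 ε₁ ε₂ ε₃ ε₄ u₁ u₂ u₃ u₄ =
    represents-i (from-yes table-i?) ε₁ ε₂ ε₃ u₁ u₂ u₃
  , (λ { _ (inj₁ refl) → represents-ii 1 2 refl (from-yes (table-ii? 1 2)) ε₁ ε₂ ε₃ u₁ u₂ u₃
       ; _ (inj₂ refl) → represents-ii 3 0 refl (from-yes (table-ii? 3 0)) ε₁ ε₂ ε₃ u₁ u₂ u₃ })
  , (λ { _ (inj₁ refl) → represents-iii 0 3 refl (from-yes (table-iii? 0 3)) ε₁ ε₂ ε₃ ε₄ u₁ u₂ u₃ u₄
       ; _ (inj₂ refl) → represents-iii 2 1 refl (from-yes (table-iii? 2 1)) ε₁ ε₂ ε₃ ε₄ u₁ u₂ u₃ u₄ })
  , (λ { _ (inj₁ refl)        → represents-iv 1 2 refl (from-yes (table-iv? 1 2)) ε₁ ε₂ u₁ u₂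
       ; _ (inj₂ (inj₁ refl)) → represents-iv 2 1 refl (from-yes (table-iv? 2 1)) ε₁ ε₂ u₁ u₂
       ; _ (inj₂ (inj₂ refl)) → represents-iv 3 0 refl (from-yes (table-iv? 3 0)) ε₁ ε₂ u₁ u₂ })
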